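{- Let $G=\bigoplus_{n\geq 2}\mathbb{Z}/n\mathbb{Z}$ and let $S\subseteq G$ be the set of elements all of whose coordinates are $0$ except exactly one, which is equal to $1$. Let $G'=G\oplus\mathbb{Z}$ and $S'=(S\times\{0\})\cup\{(0,1)\}$. Then the Cayley graphs $\mathrm{Cay}(G,S)$ and $\mathrm{Cay}(G',S')$ are weakly isomorphic but not isomorphic.
   Context: A graph is a pair $(V,E)$ with $E$ a set of 2-element subsets of $V$, connected and non-empty, not necessarily locally finite. $\mathrm{Cay}(G,S)$ has vertex set $G$, two distinct vertices $g,h$ being adjacent iff $g^{ -1}h\in S\cup S^{ -1}$. For a vertex $u$ and $r\geq0$, the ball $B(u,r)$ is the set of vertices at graph distance at most $r$ from $u$, viewed as the induced subgraph rooted at $u$. An isomorphism of rooted graphs is a graph isomorphism (bijection on vertices preserving adjacency and non-adjacency) sending root to root. A graph is weakly transitive if for all vertices $o,o'$ and every positive integer $n$, the rooted graphs $B(o,n)$ and $B(o',n)$ are isomorphic (e.g. every vertex-transitive graph, in particular every Cayley graph, is weakly transitive). Two weakly transitive graphs are weakly isomorphic if for every positive integer $k$, their balls of radius $k$ (around any vertex) are isomorphic as rooted graphs. -}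

module Defs where

open import Level using (0ℓ)
open import Data.Nat using (ℕ; zero; suc; _+_; _∸_; _≤_; _⊔_)
open import Data.Nat.Properties using (m≤m⊔n; m≤n⊔m; ≤-trans)
open import Data.Nat.DivMod using (_mod_)
open import Data.Fin using (Fin; toℕ) renaming (zero to fzero; suc to fsuc)
open import Data.Integer using (ℤ) renaming (_+_ to _+ℤ_; -_ to -ℤ_; 0ℤ to 0ℤ; 1ℤ to 1ℤ)
open import Data.Product using (Σ; ∃; _×_; _,_; proj₁; proj₂)
open import Data.Sum using (_⊎_; inj₁; inj₂)
open import Relation.Nullary using (¬_)
open import Relation.Binary using (Rel; IsEquivalence; Setoid)
open import Relation.Binary.PropositionalEquality using (_≡_; refl; sym; trans; cong)
open import Algebra.Bundles.Raw using (RawGroup)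
open import Function.Bundles using (Inverse; _⇔_)

record Graph : Set₁ where
  field
    V             : Set
    _≈_           : Rel V 0ℓ
    isEquivalence : IsEquivalence _≈_
    _~_           : Rel V 0ℓ

  setoid : Setoid 0ℓ 0ℓ
  setoid = record { Carrier = V ; _≈_ = _≈_ ; isEquivalence = isEquivalence }

open Graph using (V; setoid; isEquivalence)

record Iso (Γ Δ : Graph) : Set where
  field
    bij : Inverse (setoid Γ) (setoid Δ)
    adj : ∀ x y → _⇔_ (Graph._~_ Γ x y) (Graph._~_ Δ (Inverse.to bij x) (Inverse.to bij y))

Within : (Γ : Graph) → V Γ → V Γ → ℕ → Set
Within Γ u v zero    = Graph._≈_ Γ u v
Within Γ u v (suc r) = Within Γ u v r ⊎ Σ (V Γ) (λ w → Within Γ u w r × Graph._~_ Γ w v)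

within-root : (Γ : Graph) (u : V Γ) (r : ℕ) → Within Γ u u r
within-root Γ u zero    = IsEquivalence.refl (isEquivalence Γ)
within-root Γ u (suc r) = inj₁ (within-root Γ u r)

Ball : (Γ : Graph) → V Γ → ℕ → Graph
Ball Γ u r = record
  { V = Σ (V Γ) (λ v → Within Γ u v r)
  ; _≈_ = λ x y → Graph._≈_ Γ (proj₁ x) (proj₁ y)
  ; isEquivalence = record
      { refl  = IsEquivalence.refl (isEquivalence Γ)
      ; sym   = IsEquivalence.sym (isEquivalence Γ)
      ; trans = IsEquivalence.trans (isEquivalence Γ) }
  ; _~_ = λ x y → Graph._~_ Γ (proj₁ x) (proj₁ y)
  }

RootedBallIso : (Γ Δ : Graph) → V Γ → V Δ → ℕ → Set
RootedBallIso Γ Δ u v r =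
  Σ (Iso (Ball Γ u r) (Ball Δ v r))
    (λ φ → Graph._≈_ Δ (proj₁ (Inverse.to (Iso.bij φ) (u , within-root Γ u r))) v)

WeaklyIsomorphic : Graph → Graph → Set
WeaklyIsomorphic Γ Δ = (k : ℕ) → (u : V Γ) → (v : V Δ) → RootedBallIso Γ Δ u v (suc k)

Cay : (G : RawGroup 0ℓ 0ℓ) → IsEquivalence (RawGroup._≈_ G) → (RawGroup.Carrier G → Set) → Graph
Cay G eq S = record
  { V = Carrier
  ; _≈_ = _≈_
  ; isEquivalence = eq
  ; _~_ = λ g h → ¬ (g ≈ h) × Σ Carrier (λ s → S s × ((g ⁻¹ ∙ h ≈ s) ⊎ (g ⁻¹ ∙ h ≈ s ⁻¹)))
  }
  where open RawGroup G

-- G = ⊕_{n ≥ 2} ℤ/nℤ : coordinate i lives in ℤ/(i+2)ℤ, represented by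
-- Fin (2 + i); finitely supported sequences.

record DSum : Set where
  field
    coord   : (i : ℕ) → Fin (suc (suc i))
    bound   : ℕ
    support : ∀ i → bound ≤ i → coord i ≡ fzero

open DSum

addFin : ∀ {n} → Fin (suc (suc n)) → Fin (suc (suc n)) → Fin (suc (suc n))
addFin {n} a b = (toℕ a + toℕ b) mod (suc (suc n))

negFin : ∀ {n} → Fin (suc (suc n)) → Fin (suc (suc n))
negFin fzero        = fzero
negFin {n} a@(fsuc _) = (suc (suc n) ∸ toℕ a) mod (suc (suc n))

private
  add0 : ∀ {n} (a b : Fin (suc (suc n))) → a ≡ fzero → b ≡ fzero → addFin a b ≡ fzero
  add0 a b refl refl = refl

  neg0 : ∀ {n} (a : Fin (suc (suc n))) → a ≡ fzero → negFin a ≡ fzero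
  neg0 a refl = refl

_⊕_ : DSum → DSum → DSum
x ⊕ y = record
  { coord = λ i → addFin (coord x i) (coord y i)
  ; bound = bound x ⊔ bound y
  ; support = λ i p → add0 (coord x i) (coord y i)
      (support x i (≤-trans (m≤m⊔n (bound x) (bound y)) p))
      (support y i (≤-trans (m≤n⊔m (bound x) (bound y)) p))
  }

⊖_ : DSum → DSum
⊖ x = record
  { coord = λ i → negFin (coord x i)
  ; bound = bound x
  ; support = λ i p → neg0 (coord x i) (support x i p)
  }

zeroD : DSum
zeroD = record { coord = λ _ → fzero ; bound = 0 ; support = λ _ _ → refl }

_≈D_ : Rel DSum 0ℓ
x ≈D y = ∀ i → coord x i ≡ coord y i

≈D-equiv : IsEquivalence _≈D_
≈D-equiv = record
  { refl = λ i → refl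
  ; sym = λ p i → sym (p i)
  ; trans = λ p q i → trans (p i) (q i) }

Grp : RawGroup 0ℓ 0ℓ
Grp = record { Carrier = DSum ; _≈_ = _≈D_ ; _∙_ = _⊕_ ; ε = zeroD ; _⁻¹ = ⊖_ }

SGen : DSum → Set
SGen x = Σ ℕ (λ j → coord x j ≡ fsuc fzero × (∀ i → ¬ (i ≡ j) → coord x i ≡ fzero))

CayG : Graph
CayG = Cay Grp ≈D-equiv SGen

_≈P_ : Rel (DSum × ℤ) 0ℓ
(x , a) ≈P (y , b) = x ≈D y × a ≡ b

≈P-equiv : IsEquivalence _≈P_
≈P-equiv = record
  { refl = (λ i → refl) , refl
  ; sym = λ { (p , q) → (λ i → sym (p i)) , sym q }
  ; trans = λ { (p , q) (p' , q') → (λ i → trans (p i) (p' i)) , trans q q' } }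

Grp' : RawGroup 0ℓ 0ℓ
Grp' = record
  { Carrier = DSum × ℤ
  ; _≈_ = _≈P_
  ; _∙_ = λ { (x , a) (y , b) → (x ⊕ y , a +ℤ b) }
  ; ε = (zeroD , 0ℤ)
  ; _⁻¹ = λ { (x , a) → (⊖ x , -ℤ a) }
  }

SGen' : DSum × ℤ → Set
SGen' (x , a) = (SGen x × a ≡ 0ℤ) ⊎ (x ≈D zeroD × a ≡ 1ℤ)

CayG' : Graph
CayG' = Cay Grp' ≈P-equiv SGen'

-- Around any vertex, the ball of radius R in Cay(G,S) only reaches elements whose coordinates
-- in the factors ℤ/nℤ with n > 2R + 2 differ from those of the centre by at most R, and in that
-- range ℤ/nℤ looks like ℤ. So keeping the coordinates below M = 2R + 2, moving coordinate M to
-- the ℤ factor of G' and shifting the coordinates above M down by one identifies the balls of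
-- radius R of Cay(G,S) and Cay(G',S').
-- The graphs are not isomorphic: the vertices (0,k) of Cay(G',S') form a ray in which each
-- vertex is the only common neighbour of its two neighbours. In the Cayley graph of an abelian
-- group such a ray has constant increments, so when every generator has finite order, as in G,
-- it returns to its starting vertex.

module Submission where

open import Defs
open import Data.Product using (_×_)
open import Relation.Nullary using (¬_)

open import Level using (0ℓ)
open import Algebra.Bundles using (Group; AbelianGroup)
import Algebra.Construct.DirectProduct as DirectProduct
import Algebra.Properties.AbelianGroup as AbelianGroupProperties
import Algebra.Properties.Group as GroupProperties
import Algebra.Properties.Monoid.Mult as MonoidMultProperties
open import Data.Nat as ℕ using (ℕ; zero; suc; _+_; _∸_; _≤_; _<_; z≤n; s≤s; _%_; _≟_; _≤?_; _<?_; _⊔_)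
import Data.Nat.Properties as ℕ
open import Data.Nat.DivMod using (_mod_; %-distribˡ-+; m%n%n≡m%n; n%n≡0; m<n⇒m%n≡m; m%n<n; m*n%n≡0)
open import Data.Fin using (Fin; toℕ) renaming (zero to fzero; suc to fsuc)
open import Data.Fin.Properties using (toℕ-injective; toℕ<n; toℕ-fromℕ<)
open import Data.Integer as ℤ using (ℤ; +_; -[1+_]; ∣_∣; 0ℤ; 1ℤ; -1ℤ)
import Data.Integer.Properties as ℤ
open import Data.Product using (Σ-syntax; _,_; proj₁; proj₂; map₂)
open import Data.Sum using (_⊎_; inj₁; inj₂)
open import Data.Empty using (⊥; ⊥-elim)
open import Function.Bundles using (Inverse; Equivalence; _⇔_; mk⇔)
open import Relation.Nullary using (yes; no; Dec)
open import Relation.Binary using (Rel; IsEquivalence; tri<; tri≈; tri>)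

open DSum
open Graph using (V)

module GroupLemmas (G : Group 0ℓ 0ℓ) where
  open Group G
  open GroupProperties G
  open import Relation.Binary.Reasoning.Setoid setoid

  x\\y≈z⇒y≈x∙z : ∀ {x y z} → x \\ y ≈ z → y ≈ x ∙ z
  x\\y≈z⇒y≈x∙z {x} {y} {z} eq = begin
    y             ≈⟨ \\-leftDividesˡ x y ⟨
    x ∙ (x \\ y)  ≈⟨ ∙-congˡ eq ⟩
    x ∙ z         ∎

  y≈x∙z⇒x\\y≈z : ∀ {x y z} → y ≈ x ∙ z → x \\ y ≈ z
  y≈x∙z⇒x\\y≈z {x} {y} {z} eq = sym (y≈x\\z x z y (sym eq))

  x\\y≈ε⇒x≈y : ∀ {x y} → x \\ y ≈ ε → x ≈ y
  x\\y≈ε⇒x≈y {x} eq = sym (trans (x\\y≈z⇒y≈x∙z eq) (identityʳ x))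

  x≈y⇒x\\y≈ε : ∀ {x y} → x ≈ y → x \\ y ≈ ε
  x≈y⇒x\\y≈ε {x} x≈y = y≈x∙z⇒x\\y≈z (trans (sym x≈y) (sym (identityʳ x)))

  \\-translate : ∀ c x y → (c ∙ x) \\ (c ∙ y) ≈ x \\ y
  \\-translate c x y = begin
    (c ∙ x) ⁻¹ ∙ (c ∙ y)       ≈⟨ ∙-congʳ (⁻¹-anti-homo-∙ c x) ⟩
    x ⁻¹ ∙ c ⁻¹ ∙ (c ∙ y)      ≈⟨ assoc (x ⁻¹) (c ⁻¹) (c ∙ y) ⟩
    x ⁻¹ ∙ (c ⁻¹ ∙ (c ∙ y))    ≈⟨ ∙-congˡ (\\-leftDividesʳ c y) ⟩
    x ⁻¹ ∙ y                   ∎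

module Cayley (G : Group 0ℓ 0ℓ) (S : Group.Carrier G → Set) where
  open Group G
  open GroupProperties G
  open GroupLemmas G

  Gen± : Carrier → Set
  Gen± d = Σ[ s ∈ Carrier ] S s × (d ≈ s ⊎ d ≈ s ⁻¹)

  -- definitionally the adjacency of  Cay rawGroup eq S  for any  eq
  _~_ : Rel Carrier 0ℓ
  x ~ y = ¬ x ≈ y × Gen± (x \\ y)

  Gen±-resp : ∀ {d d'} → d ≈ d' → Gen± d → Gen± d'
  Gen±-resp d≈d' (s , Ss , inj₁ d≈s)  = s , Ss , inj₁ (trans (sym d≈d') d≈s)
  Gen±-resp d≈d' (s , Ss , inj₂ d≈s⁻¹) = s , Ss , inj₂ (trans (sym d≈d') d≈s⁻¹)

  Gen±-⁻¹ : ∀ {d} → Gen± d → Gen± (d ⁻¹)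
  Gen±-⁻¹ (s , Ss , inj₁ d≈s)  = s , Ss , inj₂ (⁻¹-cong d≈s)
  Gen±-⁻¹ (s , Ss , inj₂ d≈s⁻¹) = s , Ss , inj₁ (trans (⁻¹-cong d≈s⁻¹) (⁻¹-involutive s))

  ~-resp-≈ : ∀ {x x' y y'} → x ≈ x' → y ≈ y' → x ~ y → x' ~ y'
  ~-resp-≈ x≈x' y≈y' (x≉y , gen) =
    (λ x'≈y' → x≉y (trans x≈x' (trans x'≈y' (sym y≈y')))) ,
    Gen±-resp (\\-cong₂ x≈x' y≈y') gen

  ~-sym : ∀ {x y} → x ~ y → y ~ x
  ~-sym {x} {y} (x≉y , gen) = (λ y≈x → x≉y (sym y≈x)) , Gen±-resp (⁻¹-anti-homo-\\ x y) (Gen±-⁻¹ gen)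

  ~-translate : ∀ c {x y} → x ~ y → (c ∙ x) ~ (c ∙ y)
  ~-translate c {x} {y} (x≉y , gen) = (λ cx≈cy → x≉y (∙-cancelˡ c x y cx≈cy)) , Gen±-resp (sym (\\-translate c x y)) gen

  module _ (S∌ε : ∀ s → S s → ¬ s ≈ ε) where

    Gen±∌ε : ∀ {d} → Gen± d → ¬ d ≈ ε
    Gen±∌ε (s , Ss , inj₁ d≈s)  d≈ε = S∌ε s Ss (trans (sym d≈s) d≈ε)
    Gen±∌ε (s , Ss , inj₂ d≈s⁻¹) d≈ε =
      S∌ε s Ss (trans (sym (⁻¹-involutive s)) (trans (⁻¹-cong (trans (sym d≈s⁻¹) d≈ε)) ε⁻¹≈ε))

    Gen±⇒~ : ∀ {x y} → Gen± (x \\ y) → x ~ y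
    Gen±⇒~ gen = (λ x≈y → Gen±∌ε gen (x≈y⇒x\\y≈ε x≈y)) , gen

module Steps (G : AbelianGroup 0ℓ 0ℓ) (one : AbelianGroup.Carrier G) where
  open AbelianGroup G
  open Group group using (_\\_)
  open AbelianGroupProperties G using (xyx⁻¹≈y)
  open GroupLemmas group
  open import Relation.Binary.Reasoning.Setoid setoid

  infix 4 _─_
  _─_ : Rel Carrier 0ℓ
  x ─ y = y ≈ one ∙ x ⊎ x ≈ one ∙ y

  ─⇒\\ : ∀ {x y} → x ─ y → x \\ y ≈ one ⊎ x \\ y ≈ one ⁻¹
  ─⇒\\ {x} {y} (inj₁ y≈1x) = inj₁ (y≈x∙z⇒x\\y≈z (trans y≈1x (comm one x)))
  ─⇒\\ {x} {y} (inj₂ x≈1y) = inj₂ (y≈x∙z⇒x\\y≈z (begin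
    y               ≈⟨ xyx⁻¹≈y one y ⟨
    one ∙ y ∙ one ⁻¹ ≈⟨ ∙-congʳ x≈1y ⟨
    x ∙ one ⁻¹       ∎))

  \\⇒─ : ∀ {x y} → x \\ y ≈ one ⊎ x \\ y ≈ one ⁻¹ → x ─ y
  \\⇒─ {x} {y} (inj₁ x\\y≈1) = inj₁ (trans (x\\y≈z⇒y≈x∙z x\\y≈1) (comm x one))
  \\⇒─ {x} {y} (inj₂ x\\y≈1⁻¹) = inj₂ (begin
    x                ≈⟨ xyx⁻¹≈y one x ⟨
    one ∙ x ∙ one ⁻¹ ≈⟨ assoc one x (one ⁻¹) ⟩
    one ∙ (x ∙ one ⁻¹) ≈⟨ ∙-congˡ (x\\y≈z⇒y≈x∙z x\\y≈1⁻¹) ⟨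
    one ∙ y          ∎)

module StraightPaths (G : AbelianGroup 0ℓ 0ℓ) (S : AbelianGroup.Carrier G → Set)
                     (S∌ε : ∀ s → S s → ¬ AbelianGroup._≈_ G s (AbelianGroup.ε G)) where
  open AbelianGroup G
  open Group group using (_\\_)
  open GroupProperties group
  open Cayley group S
  open MonoidMultProperties monoid using () renaming (_×_ to _·_)
  open import Relation.Binary.Reasoning.Setoid setoid

  straight-path-returns :
    (∀ d → Gen± d → Σ[ t ∈ ℕ ] suc t · d ≈ ε) →
    (q : ℕ → Carrier) → (∀ k → q k ~ q (suc k)) →
    (∀ k x → x ~ q k → x ~ q (suc (suc k)) → x ≈ q (suc k)) →
    Σ[ t ∈ ℕ ] q (suc t) ≈ q 0
  straight-path-returns torsion q adjacent middle = map₂ q-returns (torsion (step 0) (proj₂ (adjacent 0)))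
    where
      step : ℕ → Carrier
      step k = q k \\ q (suc k)

      -- q k ∙ step (suc k) is a common neighbour of q k and q (2 + k), hence equals q (suc k)
      step-suc : ∀ k → step (suc k) ≈ step k
      step-suc k = y≈x\\z (q k) (step (suc k)) (q (suc k)) detour≈q₁
        where
          detour : Carrier
          detour = q k ∙ step (suc k)
          detour∙step≈q₂ : detour ∙ step k ≈ q (suc (suc k))
          detour∙step≈q₂ = begin
            q k ∙ step (suc k) ∙ step k       ≈⟨ ∙-congʳ (comm (q k) (step (suc k))) ⟩
            step (suc k) ∙ q k ∙ step k       ≈⟨ assoc (step (suc k)) (q k) (step k) ⟩
            step (suc k) ∙ (q k ∙ step k)     ≈⟨ ∙-congˡ (\\-leftDividesˡ (q k) (q (suc k))) ⟩
            step (suc k) ∙ q (suc k)          ≈⟨ comm (step (suc k)) (q (suc k)) ⟩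
            q (suc k) ∙ step (suc k)          ≈⟨ \\-leftDividesˡ (q (suc k)) (q (suc (suc k))) ⟩
            q (suc (suc k))                   ∎
          q~detour : q k ~ detour
          q~detour = Gen±⇒~ S∌ε (Gen±-resp (sym (\\-leftDividesʳ (q k) (step (suc k)))) (proj₂ (adjacent (suc k))))
          detour~q₂ : detour ~ q (suc (suc k))
          detour~q₂ = Gen±⇒~ S∌ε (Gen±-resp (y≈x\\z detour (step k) (q (suc (suc k))) detour∙step≈q₂) (proj₂ (adjacent k)))
          detour≈q₁ : detour ≈ q (suc k)
          detour≈q₁ = middle k detour (~-sym q~detour) detour~q₂

      step-const : ∀ k → step k ≈ step 0
      step-const zero    = refl
      step-const (suc k) = trans (step-suc k) (step-const k)

      q-formula : ∀ k → q k ≈ q 0 ∙ k · step 0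
      q-formula zero    = sym (identityʳ (q 0))
      q-formula (suc k) = begin
        q (suc k)                          ≈⟨ \\-leftDividesˡ (q k) (q (suc k)) ⟨
        q k ∙ step k                       ≈⟨ ∙-cong (q-formula k) (step-const k) ⟩
        q 0 ∙ k · step 0 ∙ step 0          ≈⟨ assoc (q 0) (k · step 0) (step 0) ⟩
        q 0 ∙ (k · step 0 ∙ step 0)        ≈⟨ ∙-congˡ (comm (k · step 0) (step 0)) ⟩
        q 0 ∙ suc k · step 0               ∎

      q-returns : ∀ {t} → suc t · step 0 ≈ ε → q (suc t) ≈ q 0
      q-returns {t} t·step≈ε = begin
        q (suc t)                 ≈⟨ q-formula (suc t) ⟩
        q 0 ∙ suc t · step 0      ≈⟨ ∙-congˡ t·step≈ε ⟩
        q 0 ∙ ε                   ≈⟨ identityʳ (q 0) ⟩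
        q 0                       ∎

open import Relation.Binary.PropositionalEquality

module _ {n : ℕ} where
  private
    m : ℕ
    m = suc (suc n)

  toℕ-mod : ∀ k → toℕ (k mod m) ≡ k % m
  toℕ-mod k = toℕ-fromℕ< (m%n<n k m)

  toℕ-addFin : (a b : Fin m) → toℕ (addFin a b) ≡ (toℕ a + toℕ b) % m
  toℕ-addFin a b = toℕ-mod (toℕ a + toℕ b)

  toℕ-negFin : (a : Fin m) → toℕ (negFin a) ≡ (m ∸ toℕ a) % m
  toℕ-negFin fzero    = sym (n%n≡0 m)
  toℕ-negFin (fsuc a) = toℕ-mod (m ∸ suc (toℕ a))

  %-absorbˡ-+ : ∀ x y → (x % m + y) % m ≡ (x + y) % m
  %-absorbˡ-+ x y = begin
    (x % m + y) % m          ≡⟨ %-distribˡ-+ (x % m) y m ⟩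
    (x % m % m + y % m) % m  ≡⟨ cong (λ z → (z + y % m) % m) (m%n%n≡m%n x m) ⟩
    (x % m + y % m) % m      ≡⟨ %-distribˡ-+ x y m ⟨
    (x + y) % m              ∎
    where open ≡-Reasoning

  %-absorbʳ-+ : ∀ x y → (x + y % m) % m ≡ (x + y) % m
  %-absorbʳ-+ x y = begin
    (x + y % m) % m  ≡⟨ cong (_% m) (ℕ.+-comm x (y % m)) ⟩
    (y % m + x) % m  ≡⟨ %-absorbˡ-+ y x ⟩
    (y + x) % m      ≡⟨ cong (_% m) (ℕ.+-comm y x) ⟩
    (x + y) % m      ∎
    where open ≡-Reasoning

  addFin-comm : (a b : Fin m) → addFin a b ≡ addFin b a
  addFin-comm a b = cong (_mod m) (ℕ.+-comm (toℕ a) (toℕ b))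

  addFin-assoc : (a b c : Fin m) → addFin (addFin a b) c ≡ addFin a (addFin b c)
  addFin-assoc a b c = toℕ-injective (begin
    toℕ (addFin (addFin a b) c)        ≡⟨ toℕ-addFin (addFin a b) c ⟩
    (toℕ (addFin a b) + toℕ c) % m     ≡⟨ cong (λ z → (z + toℕ c) % m) (toℕ-addFin a b) ⟩
    ((toℕ a + toℕ b) % m + toℕ c) % m  ≡⟨ %-absorbˡ-+ (toℕ a + toℕ b) (toℕ c) ⟩
    (toℕ a + toℕ b + toℕ c) % m        ≡⟨ cong (_% m) (ℕ.+-assoc (toℕ a) (toℕ b) (toℕ c)) ⟩
    (toℕ a + (toℕ b + toℕ c)) % m      ≡⟨ %-absorbʳ-+ (toℕ a) (toℕ b + toℕ c) ⟨
    (toℕ a + (toℕ b + toℕ c) % m) % m  ≡⟨ cong (λ z → (toℕ a + z) % m) (toℕ-addFin b c) ⟨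
    (toℕ a + toℕ (addFin b c)) % m     ≡⟨ toℕ-addFin a (addFin b c) ⟨
    toℕ (addFin a (addFin b c))        ∎)
    where open ≡-Reasoning

  addFin-identityˡ : (a : Fin m) → addFin fzero a ≡ a
  addFin-identityˡ a = toℕ-injective (trans (toℕ-addFin fzero a) (m<n⇒m%n≡m (toℕ<n a)))

  negFin-inverseˡ : (a : Fin m) → addFin (negFin a) a ≡ fzero
  negFin-inverseˡ a = toℕ-injective (begin
    toℕ (addFin (negFin a) a)      ≡⟨ toℕ-addFin (negFin a) a ⟩
    (toℕ (negFin a) + toℕ a) % m   ≡⟨ cong (λ z → (z + toℕ a) % m) (toℕ-negFin a) ⟩
    ((m ∸ toℕ a) % m + toℕ a) % m  ≡⟨ %-absorbˡ-+ (m ∸ toℕ a) (toℕ a) ⟩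
    (m ∸ toℕ a + toℕ a) % m        ≡⟨ cong (_% m) (ℕ.m∸n+n≡m (ℕ.<⇒≤ (toℕ<n a))) ⟩
    m % m                          ≡⟨ n%n≡0 m ⟩
    0                              ∎)
    where open ≡-Reasoning

Fin-+-abelianGroup : ℕ → AbelianGroup 0ℓ 0ℓ
Fin-+-abelianGroup n = record
  { Carrier = Fin (suc (suc n))
  ; _≈_ = _≡_
  ; _∙_ = addFin
  ; ε = fzero
  ; _⁻¹ = negFin
  ; isAbelianGroup = record
    { isGroup = record
      { isMonoid = record
        { isSemigroup = record { isMagma = record { isEquivalence = isEquivalence ; ∙-cong = cong₂ addFin } ; assoc = addFin-assoc }
        ; identity = addFin-identityˡ , λ a → trans (addFin-comm a fzero) (addFin-identityˡ a) }
      ; inverse = negFin-inverseˡ , λ a → trans (addFin-comm a (negFin a)) (negFin-inverseˡ a)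
      ; ⁻¹-cong = cong negFin }
    ; comm = addFin-comm } }

module ℤ/ {n : ℕ} where
  open AbelianGroup (Fin-+-abelianGroup n) public
  open AbelianGroupProperties (Fin-+-abelianGroup n) public
  open GroupLemmas group public
  open MonoidMultProperties monoid public using (×-idem) renaming (_×_ to _·_)

module _ {n : ℕ} where
  private
    m : ℕ
    m = suc (suc n)
  open ℤ/ {n} using (_·_)

  toℕ-· : ∀ k (c : Fin m) → toℕ (k · c) ≡ (k ℕ.* toℕ c) % m
  toℕ-· zero    c = refl
  toℕ-· (suc k) c = begin
    toℕ (addFin c (k · c))           ≡⟨ toℕ-addFin c (k · c) ⟩
    (toℕ c + toℕ (k · c)) % m        ≡⟨ cong (λ x → (toℕ c + x) % m) (toℕ-· k c) ⟩
    (toℕ c + (k ℕ.* toℕ c) % m) % m  ≡⟨ %-absorbʳ-+ (toℕ c) (k ℕ.* toℕ c) ⟩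
    (toℕ c + k ℕ.* toℕ c) % m        ∎
    where open ≡-Reasoning

  m·c≡0 : ∀ (c : Fin m) → m · c ≡ fzero
  m·c≡0 c = toℕ-injective (begin
    toℕ (m · c)               ≡⟨ toℕ-· m c ⟩
    (m ℕ.* toℕ c) % m         ≡⟨ cong (_% m) (ℕ.*-comm m (toℕ c)) ⟩
    (toℕ c ℕ.* m) % m         ≡⟨ m*n%n≡0 (toℕ c) m ⟩
    0                         ∎)
    where open ≡-Reasoning

DSum-abelianGroup : AbelianGroup 0ℓ 0ℓ
DSum-abelianGroup = record
  { Carrier = DSum ; _≈_ = _≈D_ ; _∙_ = _⊕_ ; ε = zeroD ; _⁻¹ = ⊖_
  ; isAbelianGroup = record
    { isGroup = record
      { isMonoid = record
        { isSemigroup = record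
          { isMagma = record { isEquivalence = ≈D-equiv ; ∙-cong = λ p q i → cong₂ addFin (p i) (q i) }
          ; assoc = λ x y z i → ℤ/.assoc (coord x i) (coord y i) (coord z i) }
        ; identity = (λ x i → ℤ/.identityˡ (coord x i)) , (λ x i → ℤ/.identityʳ (coord x i)) }
      ; inverse = (λ x i → ℤ/.inverseˡ (coord x i)) , (λ x i → ℤ/.inverseʳ (coord x i))
      ; ⁻¹-cong = λ p i → cong negFin (p i) }
    ; comm = λ x y i → ℤ/.comm (coord x i) (coord y i) } }

DSum×ℤ-abelianGroup : AbelianGroup 0ℓ 0ℓ
DSum×ℤ-abelianGroup = DirectProduct.abelianGroup DSum-abelianGroup ℤ.+-0-abelianGroup

module 𝔾 where
  open AbelianGroup DSum-abelianGroup public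
  open Group group public using (_\\_)
  open Cayley group SGen public
  open MonoidMultProperties monoid public using () renaming (_×_ to _·_)
  open GroupLemmas group public
  open GroupProperties group public

module 𝔾' where
  open AbelianGroup DSum×ℤ-abelianGroup public
  open Group group public using (_\\_)
  open Cayley group SGen' public
  open GroupLemmas group public
  open GroupProperties group public

one : ∀ {n} → Fin (suc (suc n))
one = fsuc fzero

module _ {n : ℕ} where
  open Steps (Fin-+-abelianGroup n) one public

open Steps ℤ.+-0-abelianGroup 1ℤ public
  using () renaming (_─_ to _─ℤ_; ─⇒\\ to ─ℤ⇒\\; \\⇒─ to \\⇒─ℤ)

unit : ℕ → DSum
unit j = record
  { coord   = λ i → δ (i ≟ j)
  ; bound   = suc j
  ; support = λ i j<i → δ-≢ (i ≟ j) (λ i≡j → ℕ.<-irrefl (sym i≡j) j<i) }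
  where
    δ : ∀ {i} → Dec (i ≡ j) → Fin (suc (suc i))
    δ (yes _) = one
    δ (no _)  = fzero
    δ-≢ : ∀ {i} (d : Dec (i ≡ j)) → i ≢ j → δ d ≡ fzero
    δ-≢ (yes i≡j) i≢j = ⊥-elim (i≢j i≡j)
    δ-≢ (no _)    _   = refl

unit-at : ∀ j → coord (unit j) j ≡ one
unit-at j with j ≟ j
... | yes _  = refl
... | no j≢j = ⊥-elim (j≢j refl)

unit-off : ∀ {i j} → i ≢ j → coord (unit j) i ≡ fzero
unit-off {i} {j} i≢j with i ≟ j
... | yes i≡j = ⊥-elim (i≢j i≡j)
... | no _    = refl

unit-SGen : ∀ j → SGen (unit j)
unit-SGen j = j , unit-at j , λ i → unit-off

IsUnitAt : ℕ → DSum → Set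
IsUnitAt j d = (coord d j ≡ one ⊎ coord d j ≡ negFin one) × (∀ i → i ≢ j → coord d i ≡ fzero)

Gen±⇒IsUnitAt : ∀ {d} → 𝔾.Gen± d → Σ[ j ∈ ℕ ] IsUnitAt j d
Gen±⇒IsUnitAt (s , (j , sⱼ≡1 , s₀) , inj₁ d≈s)  =
  j , inj₁ (trans (d≈s j) sⱼ≡1) , λ i i≢j → trans (d≈s i) (s₀ i i≢j)
Gen±⇒IsUnitAt (s , (j , sⱼ≡1 , s₀) , inj₂ d≈-s) =
  j , inj₂ (trans (d≈-s j) (cong negFin sⱼ≡1)) , λ i i≢j → trans (d≈-s i) (cong negFin (s₀ i i≢j))

IsUnitAt⇒Gen± : ∀ {j d} → IsUnitAt j d → 𝔾.Gen± d
IsUnitAt⇒Gen± {j} {d} (dⱼ≡±1 , d₀) = unit j , unit-SGen j , agree dⱼ≡±1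
  where
    agreeUpTo : (g : ∀ {i} → Fin (suc (suc i)) → Fin (suc (suc i))) → (∀ {i} → g {i} fzero ≡ fzero) →
                coord d j ≡ g one → ∀ i → coord d i ≡ g (coord (unit j) i)
    agreeUpTo g g0≡0 dⱼ≡g1 i with i ≟ j
    ... | yes refl = dⱼ≡g1
    ... | no i≢j   = trans (d₀ i i≢j) (sym g0≡0)
    agree : coord d j ≡ one ⊎ coord d j ≡ negFin one → d ≈D unit j ⊎ d ≈D (⊖ unit j)
    agree (inj₁ dⱼ≡1)  = inj₁ (agreeUpTo (λ c → c) refl dⱼ≡1)
    agree (inj₂ dⱼ≡-1) = inj₂ (agreeUpTo negFin refl dⱼ≡-1)

UnitStep : DSum → DSum → Set
UnitStep x y = Σ[ j ∈ ℕ ] coord x j ─ coord y j × (∀ i → i ≢ j → coord x i ≡ coord y i)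

UnitStep⇒Gen± : ∀ {x y} → UnitStep x y → 𝔾.Gen± (x 𝔾.\\ y)
UnitStep⇒Gen± {x} {y} (j , xⱼ─yⱼ , same) =
  IsUnitAt⇒Gen± {j} {x 𝔾.\\ y} (─⇒\\ xⱼ─yⱼ , λ i i≢j → ℤ/.x≈y⇒x\\y≈ε (same i i≢j))

Gen±⇒UnitStep : ∀ {x y} → 𝔾.Gen± (x 𝔾.\\ y) → UnitStep x y
Gen±⇒UnitStep {x} {y} gen with Gen±⇒IsUnitAt {x 𝔾.\\ y} gen
... | j , ±1 , d₀ = j , \\⇒─ {x = coord x j} {coord y j} ±1 , λ i i≢j → ℤ/.x\\y≈ε⇒x≈y (d₀ i i≢j)

SGen∌ε : ∀ s → SGen s → ¬ s ≈D zeroD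
SGen∌ε s (j , sⱼ≡1 , _) s≈0 with trans (sym sⱼ≡1) (s≈0 j)
... | ()

~⇒UnitStep : ∀ {x y} → x 𝔾.~ y → UnitStep x y
~⇒UnitStep {x} {y} (_ , gen) = Gen±⇒UnitStep {x} {y} gen

UnitStep⇒~ : ∀ {x y} → UnitStep x y → x 𝔾.~ y
UnitStep⇒~ {x} {y} step = 𝔾.Gen±⇒~ SGen∌ε {x} {y} (UnitStep⇒Gen± {x} {y} step)

module ℤ-group = GroupLemmas (AbelianGroup.group ℤ.+-0-abelianGroup)

SplitGen± : DSum → ℤ → Set
SplitGen± d k = (𝔾.Gen± d × k ≡ 0ℤ) ⊎ (d ≈D zeroD × (k ≡ 1ℤ ⊎ k ≡ -1ℤ))

Gen±'⇒SplitGen± : ∀ {d k} → 𝔾'.Gen± (d , k) → SplitGen± d k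
Gen±'⇒SplitGen± ((s , _) , inj₁ (Ss , s₂≡0) , inj₁ (d≈s , k≡s₂))   = inj₁ ((s , Ss , inj₁ d≈s) , trans k≡s₂ s₂≡0)
Gen±'⇒SplitGen± ((s , _) , inj₁ (Ss , s₂≡0) , inj₂ (d≈-s , k≡-s₂)) = inj₁ ((s , Ss , inj₂ d≈-s) , trans k≡-s₂ (cong ℤ.-_ s₂≡0))
Gen±'⇒SplitGen± (_ , inj₂ (s₁≈0 , s₂≡1) , inj₁ (d≈s₁ , k≡s₂)) =
  inj₂ ((λ i → trans (d≈s₁ i) (s₁≈0 i)) , inj₁ (trans k≡s₂ s₂≡1))
Gen±'⇒SplitGen± (_ , inj₂ (s₁≈0 , s₂≡1) , inj₂ (d≈-s₁ , k≡-s₂)) =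
  inj₂ ((λ i → trans (d≈-s₁ i) (cong negFin (s₁≈0 i))) , inj₂ (trans k≡-s₂ (cong ℤ.-_ s₂≡1)))

SplitGen±⇒Gen±' : ∀ {d k} → SplitGen± d k → 𝔾'.Gen± (d , k)
SplitGen±⇒Gen±' (inj₁ ((s , Ss , inj₁ d≈s) , k≡0))  = (s , 0ℤ) , inj₁ (Ss , refl) , inj₁ (d≈s , k≡0)
SplitGen±⇒Gen±' (inj₁ ((s , Ss , inj₂ d≈-s) , k≡0)) = (s , 0ℤ) , inj₁ (Ss , refl) , inj₂ (d≈-s , k≡0)
SplitGen±⇒Gen±' (inj₂ (d≈0 , inj₁ k≡1))  = (zeroD , 1ℤ) , inj₂ ((λ _ → refl) , refl) , inj₁ (d≈0 , k≡1)
SplitGen±⇒Gen±' (inj₂ (d≈0 , inj₂ k≡-1)) = (zeroD , 1ℤ) , inj₂ ((λ _ → refl) , refl) , inj₂ (d≈0 , k≡-1)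

UnitStep' : DSum × ℤ → DSum × ℤ → Set
UnitStep' p q = (UnitStep (proj₁ p) (proj₁ q) × proj₂ p ≡ proj₂ q)
              ⊎ (proj₁ p ≈D proj₁ q × proj₂ p ─ℤ proj₂ q)

SGen'∌ε : ∀ s → SGen' s → ¬ s 𝔾'.≈ 𝔾'.ε
SGen'∌ε (s₁ , _) (inj₁ (Ss₁ , _)) (s₁≈0 , _) = SGen∌ε s₁ Ss₁ s₁≈0
SGen'∌ε (_ , _) (inj₂ (_ , refl)) (_ , ())

~'⇒UnitStep' : ∀ {p q} → p 𝔾'.~ q → UnitStep' p q
~'⇒UnitStep' {x , a} {y , b} (_ , gen) with Gen±'⇒SplitGen± {x 𝔾.\\ y} {ℤ.- a ℤ.+ b} gen
... | inj₁ (gen₁ , a\\b≡0)  = inj₁ (Gen±⇒UnitStep {x} {y} gen₁ , ℤ-group.x\\y≈ε⇒x≈y a\\b≡0)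
... | inj₂ (x\\y≈0 , a\\b≡±1) = inj₂ (𝔾.x\\y≈ε⇒x≈y {x} {y} x\\y≈0 , \\⇒─ℤ a\\b≡±1)

UnitStep'⇒~' : ∀ {p q} → UnitStep' p q → p 𝔾'.~ q
UnitStep'⇒~' {x , a} {y , b} step = 𝔾'.Gen±⇒~ SGen'∌ε {x , a} {y , b} (SplitGen±⇒Gen±' {x 𝔾.\\ y} {ℤ.- a ℤ.+ b} (diff step))
  where
    diff : UnitStep' (x , a) (y , b) → SplitGen± (x 𝔾.\\ y) (ℤ.- a ℤ.+ b)
    diff (inj₁ (step₁ , a≡b)) = inj₁ (UnitStep⇒Gen± {x} {y} step₁ , ℤ-group.x≈y⇒x\\y≈ε a≡b)
    diff (inj₂ (x≈y , a─b))  = inj₂ (𝔾.x≈y⇒x\\y≈ε {x} {y} x≈y , ─ℤ⇒\\ a─b)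

─ℤ⇒∣b∣≤1+∣a∣ : ∀ {a b} → a ─ℤ b → ∣ b ∣ ≤ suc ∣ a ∣
─ℤ⇒∣b∣≤1+∣a∣ {a} (inj₁ refl) = ℤ.∣i+j∣≤∣i∣+∣j∣ 1ℤ a
─ℤ⇒∣b∣≤1+∣a∣ {b = b} (inj₂ refl) =
  subst (λ k → ∣ k ∣ ≤ suc ∣ ℤ.suc b ∣) (ℤ.pred-suc b) (ℤ.∣i+j∣≤∣i∣+∣j∣ -1ℤ (ℤ.suc b))

module _ {n : ℕ} where
  private
    m : ℕ
    m = suc (suc n)

  reduce : ℤ → Fin m
  reduce (+ k)    = k mod m
  reduce -[1+ k ] = negFin (suc k mod m)

  -- the integer representative of c in the window (T - m, T]
  signed : ℕ → Fin m → ℤ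
  signed T c with toℕ c ≤? T
  ... | yes _ = + toℕ c
  ... | no _  = ℤ.- (+ (m ∸ toℕ c))

  toℕ-reduce-+ : ∀ {j} → j < m → toℕ (reduce (+ j)) ≡ j
  toℕ-reduce-+ {j} j<m = trans (toℕ-mod j) (m<n⇒m%n≡m j<m)

  toℕ-reduce-[1+] : ∀ {j} → suc j < m → toℕ (reduce -[1+ j ]) ≡ m ∸ suc j
  toℕ-reduce-[1+] {j} 1+j<m = begin
    toℕ (negFin (suc j mod m))   ≡⟨ toℕ-negFin (suc j mod m) ⟩
    (m ∸ toℕ (suc j mod m)) % m  ≡⟨ cong (λ k → (m ∸ k) % m) (toℕ-reduce-+ 1+j<m) ⟩
    (m ∸ suc j) % m              ≡⟨ m<n⇒m%n≡m (s≤s (ℕ.m∸n≤m (suc n) j)) ⟩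
    m ∸ suc j                    ∎
    where open ≡-Reasoning

  reduce-signed : ∀ T (c : Fin m) → reduce (signed T c) ≡ c
  reduce-signed T c with toℕ c ≤? T
  ... | yes _   = toℕ-injective (toℕ-reduce-+ (toℕ<n c))
  ... | no c≰T  = toℕ-injective (lemma (m ∸ toℕ c) refl)
    where
      0<c : 0 < toℕ c
      0<c = ℕ.≤-<-trans z≤n (ℕ.≰⇒> c≰T)
      lemma : ∀ k → k ≡ m ∸ toℕ c → toℕ (reduce (ℤ.- (+ k))) ≡ toℕ c
      lemma zero    0≡m∸c = ⊥-elim (ℕ.<⇒≱ (toℕ<n c) (ℕ.m∸n≡0⇒m≤n (sym 0≡m∸c)))
      lemma (suc k) k≡m∸c = begin
        toℕ (reduce -[1+ k ]) ≡⟨ toℕ-reduce-[1+] (subst (_< m) (sym k≡m∸c) (ℕ.∸-monoʳ-< 0<c (ℕ.<⇒≤ (toℕ<n c)))) ⟩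
        m ∸ suc k             ≡⟨ cong (m ∸_) k≡m∸c ⟩
        m ∸ (m ∸ toℕ c)       ≡⟨ ℕ.m∸[m∸n]≡n (ℕ.<⇒≤ (toℕ<n c)) ⟩
        toℕ c                 ∎
        where open ≡-Reasoning

  signed-reduce : ∀ {T} → T + T < m → ∀ {k} → ∣ k ∣ ≤ T → signed T (reduce k) ≡ k
  signed-reduce {T} 2T<m {+ j} j≤T
    with toℕ (reduce (+ j)) ≤? T | toℕ-reduce-+ {j} (ℕ.≤-<-trans (ℕ.≤-trans j≤T (ℕ.m≤m+n T T)) 2T<m)
  ... | yes _   | toℕ≡j = cong +_ toℕ≡j
  ... | no j≰T  | toℕ≡j = ⊥-elim (j≰T (subst (_≤ T) (sym toℕ≡j) j≤T))
  signed-reduce {T} 2T<m { -[1+ j ]} j<T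
    with toℕ (reduce -[1+ j ]) ≤? T | toℕ-reduce-[1+] {j} (ℕ.≤-<-trans (ℕ.≤-trans j<T (ℕ.m≤n+m T T)) 2T<m)
  ... | yes ≤T  | toℕ≡m∸1+j = ⊥-elim (ℕ.<⇒≱ T<m∸1+j (subst (_≤ T) toℕ≡m∸1+j ≤T))
    where
      T<m∸1+j : T < m ∸ suc j
      T<m∸1+j = ℕ.m+n≤o⇒m≤o∸n (suc T) (ℕ.≤-trans (s≤s (ℕ.+-monoʳ-≤ T j<T)) 2T<m)
  ... | no _    | toℕ≡m∸1+j =
    cong (λ k → ℤ.- (+ k)) (trans (cong (m ∸_) toℕ≡m∸1+j) (ℕ.m∸[m∸n]≡n (ℕ.≤-trans (ℕ.≤-trans j<T (ℕ.m≤n+m T T)) (ℕ.<⇒≤ 2T<m))))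

  reduce-suc : ∀ k → reduce (ℤ.suc k) ≡ addFin one (reduce k)
  reduce-suc (+ j) = toℕ-injective (begin
    toℕ (suc j mod m)                 ≡⟨ toℕ-mod (suc j) ⟩
    (1 + j) % m                       ≡⟨ %-absorbʳ-+ 1 j ⟨
    (1 + j % m) % m                   ≡⟨ cong (λ k → (1 + k) % m) (toℕ-mod j) ⟨
    (1 + toℕ (j mod m)) % m           ≡⟨ toℕ-addFin one (j mod m) ⟨
    toℕ (addFin one (j mod m))        ∎)
    where open ≡-Reasoning
  reduce-suc -[1+ zero ]  = sym (ℤ/.inverseʳ one)
  reduce-suc -[1+ suc j ] = begin
    negFin x                              ≡⟨ ℤ/.identityˡ (negFin x) ⟨
    addFin fzero (negFin x)               ≡⟨ cong (λ c → addFin c (negFin x)) (ℤ/.inverseʳ one) ⟨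
    addFin (addFin one (negFin one)) (negFin x) ≡⟨ ℤ/.assoc one (negFin one) (negFin x) ⟩
    addFin one (addFin (negFin one) (negFin x)) ≡⟨ cong (addFin one) (ℤ/.⁻¹-∙-comm one x) ⟩
    addFin one (negFin (addFin one x))    ≡⟨ cong (λ c → addFin one (negFin c)) (reduce-suc (+ suc j)) ⟨
    addFin one (negFin (suc (suc j) mod m)) ∎
    where
      open ≡-Reasoning
      x : Fin m
      x = suc j mod m

  signed-unique : ∀ {T} → T + T < m → ∀ {k c} → ∣ k ∣ ≤ T → reduce k ≡ c → signed T c ≡ k
  signed-unique 2T<m ∣k∣≤T refl = signed-reduce 2T<m ∣k∣≤T

  signed-suc : ∀ {T} → T + T < m → ∀ {c d} → d ≡ addFin one c →
               ∣ signed T c ∣ < T ⊎ ∣ signed T d ∣ < T → signed T d ≡ ℤ.suc (signed T c)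
  signed-suc {T} 2T<m {c} {d} d≡1+c (inj₁ ∣c∣<T) =
    signed-unique 2T<m (ℕ.≤-trans (ℤ.∣i+j∣≤∣i∣+∣j∣ 1ℤ k) ∣c∣<T) (begin
      reduce (ℤ.suc k)    ≡⟨ reduce-suc k ⟩
      addFin one (reduce k) ≡⟨ cong (addFin one) (reduce-signed T c) ⟩
      addFin one c        ≡⟨ d≡1+c ⟨
      d                   ∎)
    where
      open ≡-Reasoning
      k : ℤ
      k = signed T c
  signed-suc {T} 2T<m {c} {d} d≡1+c (inj₂ ∣d∣<T) = begin
      signed T d                  ≡⟨ ℤ.suc-pred (signed T d) ⟨
      ℤ.suc k                     ≡⟨ cong ℤ.suc (signed-unique 2T<m {k} {c} ∣k∣≤T reduce-k≡c) ⟨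
      ℤ.suc (signed T c)          ∎
    where
      open ≡-Reasoning
      k : ℤ
      k = ℤ.pred (signed T d)
      ∣k∣≤T : ∣ k ∣ ≤ T
      ∣k∣≤T = ℕ.≤-trans (ℤ.∣i+j∣≤∣i∣+∣j∣ -1ℤ (signed T d)) ∣d∣<T
      reduce-k≡c : reduce k ≡ c
      reduce-k≡c = ℤ/.∙-cancelˡ one (reduce k) c (begin
        addFin one (reduce k) ≡⟨ reduce-suc k ⟨
        reduce (ℤ.suc k)      ≡⟨ cong reduce (ℤ.suc-pred (signed T d)) ⟩
        reduce (signed T d)   ≡⟨ reduce-signed T d ⟩
        d                     ≡⟨ d≡1+c ⟩
        addFin one c          ∎)

  signed-─ : ∀ {T} → T + T < m → ∀ {c d} → c ─ d → ∣ signed T c ∣ < T → signed T c ─ℤ signed T d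
  signed-─ 2T<m {c} {d} (inj₁ d≡1+c) ∣c∣<T = inj₁ (signed-suc 2T<m {c} {d} d≡1+c (inj₁ ∣c∣<T))
  signed-─ 2T<m {c} {d} (inj₂ c≡1+d) ∣c∣<T = inj₂ (signed-suc 2T<m {d} {c} c≡1+d (inj₂ ∣c∣<T))

  signed-─-bound : ∀ {T} → T + T < m → ∀ {c d : Fin m} {r} → c ─ d → r < T → ∣ signed T c ∣ ≤ r → ∣ signed T d ∣ ≤ suc r
  signed-─-bound 2T<m {c} {d} c─d r<T ∣c∣≤r =
    ℕ.≤-trans (─ℤ⇒∣b∣≤1+∣a∣ (signed-─ 2T<m {c} {d} c─d (ℕ.≤-<-trans ∣c∣≤r r<T))) (s≤s ∣c∣≤r)

reduce-─ : ∀ {n a b} → a ─ℤ b → reduce {n} a ─ reduce b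
reduce-─ {a = a} (inj₁ refl) = inj₁ (reduce-suc a)
reduce-─ {b = b} (inj₂ refl) = inj₂ (reduce-suc b)

transfer : ∀ {n n'} → ℕ → Fin (suc (suc n)) → Fin (suc (suc n'))
transfer T c = reduce (signed T c)

module _ {n n' : ℕ} {T : ℕ} where
  private
    m m' : ℕ
    m  = suc (suc n)
    m' = suc (suc n')

  transfer-transfer : T + T < m' → ∀ {c : Fin m} → ∣ signed T c ∣ ≤ T → transfer T (transfer {n' = n'} T c) ≡ c
  transfer-transfer 2T<m' {c} ∣c∣≤T = trans (cong reduce (signed-reduce 2T<m' {signed T c} ∣c∣≤T)) (reduce-signed T c)

  transfer-─ : T + T < m → ∀ {c d : Fin m} → c ─ d → ∣ signed T c ∣ < T → transfer {n' = n'} T c ─ transfer T d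
  transfer-─ 2T<m {c} {d} c─d ∣c∣<T = reduce-─ (signed-─ 2T<m {c} {d} c─d ∣c∣<T)

within-≤ : ∀ (Γ : Graph) {u x r s} → r ≤ s → Within Γ u x r → Within Γ u x s
within-≤ Γ {s = zero}  z≤n   x∈ = x∈
within-≤ Γ {r = zero}  {suc s} z≤n x∈ = inj₁ (within-≤ Γ {s = s} z≤n x∈)
within-≤ Γ {r = suc r} {suc s} (s≤s r≤s) (inj₁ x∈) = inj₁ (within-≤ Γ r≤s x∈)
within-≤ Γ {r = suc r} {suc s} (s≤s r≤s) (inj₂ (w , w∈ , w~x)) = inj₂ (w , within-≤ Γ r≤s w∈ , w~x)

record LocalIso (Γ Δ : Graph) (u : V Γ) (v : V Δ) (R : ℕ) : Set₁ where
  private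
    module Γ = Graph Γ
    module Δ = Graph Δ
    module Γ≈ = IsEquivalence Γ.isEquivalence
    module Δ≈ = IsEquivalence Δ.isEquivalence
  field
    to        : V Γ → V Δ
    from      : V Δ → V Γ
    to-cong   : ∀ {x y} → x Γ.≈ y → to x Δ.≈ to y
    from-cong : ∀ {x y} → x Δ.≈ y → from x Γ.≈ from y
    to-root   : v Δ.≈ to u
    Dom       : V Γ → Set
    Cod       : V Δ → Set
    ball⊆Dom  : ∀ {x} → Within Γ u x R → Dom x
    ball⊆Cod  : ∀ {y} → Within Δ v y R → Cod y
    from∘to   : ∀ {x} → Dom x → from (to x) Γ.≈ x
    to∘from   : ∀ {y} → Cod y → to (from y) Δ.≈ y
    to-adj    : ∀ {x y} → Dom x → x Γ.~ y → to x Δ.~ to y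
    from-adj  : ∀ {x y} → Cod x → x Δ.~ y → from x Γ.~ from y
    ~Γ-resp   : ∀ {x x' y y'} → x Γ.≈ x' → y Γ.≈ y' → x Γ.~ y → x' Γ.~ y'
    ~Δ-resp   : ∀ {x x' y y'} → x Δ.≈ x' → y Δ.≈ y' → x Δ.~ y → x' Δ.~ y'

  from-root : u Γ.≈ from v
  from-root = Γ≈.trans (Γ≈.sym (from∘to (ball⊆Dom (within-root Γ u R)))) (from-cong (Δ≈.sym to-root))

  reverse : LocalIso Δ Γ v u R
  reverse = record
    { to = from ; from = to ; to-cong = from-cong ; from-cong = to-cong ; to-root = from-root
    ; Dom = Cod ; Cod = Dom ; ball⊆Dom = ball⊆Cod ; ball⊆Cod = ball⊆Dom
    ; from∘to = to∘from ; to∘from = from∘to ; to-adj = from-adj ; from-adj = to-adj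
    ; ~Γ-resp = ~Δ-resp ; ~Δ-resp = ~Γ-resp }

  to-within : ∀ {x r} → r ≤ R → Within Γ u x r → Within Δ v (to x) r
  to-within {r = zero}  _   u≈x = Δ≈.trans to-root (to-cong u≈x)
  to-within {r = suc r} r<R (inj₁ x∈) = inj₁ (to-within (ℕ.<⇒≤ r<R) x∈)
  to-within {r = suc r} r<R (inj₂ (w , w∈ , w~x)) =
    inj₂ (to w , to-within (ℕ.<⇒≤ r<R) w∈ , to-adj (ball⊆Dom (within-≤ Γ (ℕ.<⇒≤ r<R) w∈)) w~x)

LocalIso⇒RootedBallIso : ∀ {Γ Δ u v R} → LocalIso Γ Δ u v R → RootedBallIso Γ Δ u v R
LocalIso⇒RootedBallIso {Γ} {Δ} {u} {v} {R} φ = record { bij = bij ; adj = adj } , Δ≈.sym to-root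
  where
    open LocalIso φ
    module Γ≈ = IsEquivalence (Graph.isEquivalence Γ)
    module Δ≈ = IsEquivalence (Graph.isEquivalence Δ)
    bij : Inverse (Graph.setoid (Ball Γ u R)) (Graph.setoid (Ball Δ v R))
    bij = record
      { to        = λ (x , x∈) → to x , to-within ℕ.≤-refl x∈
      ; from      = λ (y , y∈) → from y , LocalIso.to-within reverse ℕ.≤-refl y∈
      ; to-cong   = to-cong
      ; from-cong = from-cong
      ; inverse   = (λ {(y , y∈)} x≈from-y → Δ≈.trans (to-cong x≈from-y) (to∘from (ball⊆Cod y∈)))
                  , (λ {(x , x∈)} y≈to-x → Γ≈.trans (from-cong y≈to-x) (from∘to (ball⊆Dom x∈))) }
    adj : ∀ x y → Graph._~_ (Ball Γ u R) x y ⇔ Graph._~_ (Ball Δ v R) (Inverse.to bij x) (Inverse.to bij y)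
    adj (x , x∈) (y , y∈) = mk⇔ (to-adj (ball⊆Dom x∈))
      (λ to-x~to-y → ~Γ-resp (from∘to (ball⊆Dom x∈)) (from∘to (ball⊆Dom y∈))
                       (from-adj (ball⊆Cod (to-within ℕ.≤-refl x∈)) to-x~to-y))

-- The local isomorphism

data Around (M : ℕ) : ℕ → Set where
  below : ∀ {i} → i < M → Around M i
  at    : Around M M
  above : ∀ {i} → M ≤ i → Around M (suc i)

around : ∀ M i → Around M i
around M i       with ℕ.<-cmp i M
around M i       | tri< i<M _ _   = below i<M
around M i       | tri≈ _ refl _  = at
around M zero    | tri> _ _ ()
around M (suc i) | tri> _ _ M<1+i = above (ℕ.≤-pred M<1+i)

-- Coordinate i of G is ℤ/(i+2)ℤ. Within distance R of u, the coordinates i ≥ M of u⁻¹x lie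
-- within R of 0 while 2T < i + 2, so signed and transfer move them faithfully between moduli.
module Splice (R : ℕ) where

  T M : ℕ
  T = suc R
  M = T + T

  2T<2+i : ∀ {i} → M ≤ i → T + T < suc (suc i)
  2T<2+i M≤i = s≤s (ℕ.m≤n⇒m≤1+n M≤i)

  shiftDown : DSum → (i : ℕ) → Fin (suc (suc i))
  shiftDown z i with i <? M
  ... | yes _ = coord z i
  ... | no _  = transfer T (coord z (suc i))

  shiftDown-< : ∀ {z i} → i < M → shiftDown z i ≡ coord z i
  shiftDown-< {z} {i} i<M with i <? M
  ... | yes _  = refl
  ... | no i≮M = ⊥-elim (i≮M i<M)

  shiftDown-≥ : ∀ {z i} → M ≤ i → shiftDown z i ≡ transfer T (coord z (suc i))
  shiftDown-≥ {z} {i} M≤i with i <? M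
  ... | yes i<M = ⊥-elim (ℕ.<⇒≱ i<M M≤i)
  ... | no _    = refl

  shiftDown-cong : ∀ {z z'} i → (i < M → coord z i ≡ coord z' i) → (M ≤ i → coord z (suc i) ≡ coord z' (suc i)) →
                   shiftDown z i ≡ shiftDown z' i
  shiftDown-cong i below≡ above≡ with i <? M
  ... | yes i<M = below≡ i<M
  ... | no i≮M  = cong (transfer T) (above≡ (ℕ.≮⇒≥ i≮M))

  extract : DSum → DSum × ℤ
  extract z = record { coord = shiftDown z ; bound = bound z ; support = support-shiftDown } , signed T (coord z M)
    where
      support-shiftDown : ∀ i → bound z ≤ i → shiftDown z i ≡ fzero
      support-shiftDown i b≤i with i <? M
      ... | yes _ = support z i b≤i
      ... | no _  = cong (transfer T) (support z (suc i) (ℕ.m≤n⇒m≤1+n b≤i))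

  spliceIn : DSum → ℤ → (i : ℕ) → Fin (suc (suc i))
  spliceIn x a i with around M i
  ... | below _       = coord x i
  ... | at            = reduce a
  ... | above {i'} _  = transfer T (coord x i')

  spliceIn-< : ∀ {x a i} → i < M → spliceIn x a i ≡ coord x i
  spliceIn-< {x} {a} {i} i<M with around M i
  ... | below _   = refl
  ... | at        = ⊥-elim (ℕ.<-irrefl refl i<M)
  ... | above M≤i = ⊥-elim (ℕ.<-asym i<M (s≤s M≤i))

  spliceIn-M : ∀ {x a} → spliceIn x a M ≡ reduce a
  spliceIn-M {x} {a} with around M M
  ... | below M<M = ⊥-elim (ℕ.<-irrefl refl M<M)
  ... | at        = refl
  ... | above M≤i = ⊥-elim (ℕ.<-irrefl refl M≤i)

  spliceIn-> : ∀ {x a i} → M ≤ i → spliceIn x a (suc i) ≡ transfer T (coord x i)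
  spliceIn-> {x} {a} {i} M≤i with around M (suc i)
  ... | below 1+i<M = ⊥-elim (ℕ.<-asym 1+i<M (s≤s M≤i))
  ... | at          = ⊥-elim (ℕ.<-irrefl refl M≤i)
  ... | above _     = refl

  spliceIn-cong : ∀ {x a x' a'} i → (i < M → coord x i ≡ coord x' i) → (i ≡ M → a ≡ a') →
                  (∀ {i'} → i ≡ suc i' → M ≤ i' → coord x i' ≡ coord x' i') → spliceIn x a i ≡ spliceIn x' a' i
  spliceIn-cong i below≡ at≡ above≡ with around M i
  ... | below i<M   = below≡ i<M
  ... | at          = cong reduce (at≡ refl)
  ... | above M≤i'  = cong (transfer T) (above≡ refl M≤i')

  insert : DSum × ℤ → DSum
  insert (x , a) = record { coord = spliceIn x a ; bound = suc (bound x ⊔ M) ; support = support-spliceIn }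
    where
      support-spliceIn : ∀ i → suc (bound x ⊔ M) ≤ i → spliceIn x a i ≡ fzero
      support-spliceIn i b<i with around M i
      ... | below i<M  = ⊥-elim (ℕ.<-asym i<M (ℕ.≤-trans (s≤s (ℕ.m≤n⊔m (bound x) M)) b<i))
      ... | at         = ⊥-elim (ℕ.<-irrefl refl (ℕ.≤-trans (s≤s (ℕ.m≤n⊔m (bound x) M)) b<i))
      ... | above {i'} _ = cong (transfer T) (support x i' (ℕ.≤-trans (ℕ.m≤m⊔n (bound x) M) (ℕ.≤-pred b<i)))

  extract-cong : ∀ {z z'} → z ≈D z' → extract z 𝔾'.≈ extract z'
  extract-cong z≈z' = (λ i → shiftDown-cong i (λ _ → z≈z' i) (λ _ → z≈z' (suc i))) , cong (signed T) (z≈z' M)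

  insert-cong : ∀ {p p'} → p 𝔾'.≈ p' → insert p ≈D insert p'
  insert-cong (x≈x' , a≡a') i = spliceIn-cong i (λ _ → x≈x' i) (λ _ → a≡a') (λ {i'} _ _ → x≈x' i')

  Small : ℕ → DSum → Set
  Small r z = ∀ i → M ≤ i → ∣ signed T (coord z i) ∣ ≤ r

  Small' : ℕ → DSum × ℤ → Set
  Small' r p = Small r (proj₁ p) × ∣ proj₂ p ∣ ≤ r

  insert-extract : ∀ {z} → Small R z → insert (extract z) ≈D z
  insert-extract {z} small i with around M i
  ... | below i<M       = shiftDown-< i<M
  ... | at              = reduce-signed T (coord z M)
  ... | above {i'} M≤i' = begin
    transfer T (shiftDown z i')                  ≡⟨ cong (transfer T) (shiftDown-≥ M≤i') ⟩
    transfer T (transfer T (coord z (suc i')))   ≡⟨ transfer-transfer (2T<2+i M≤i') (ℕ.m≤n⇒m≤1+n (small (suc i') (ℕ.m≤n⇒m≤1+n M≤i'))) ⟩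
    coord z (suc i')                             ∎
    where open ≡-Reasoning

  extract-insert : ∀ {p} → Small' R p → extract (insert p) 𝔾'.≈ p
  extract-insert {x , a} (small , ∣a∣≤R) = coords , trans (cong (signed T) spliceIn-M) (signed-reduce (2T<2+i ℕ.≤-refl) (ℕ.m≤n⇒m≤1+n ∣a∣≤R))
    where
      coords : ∀ i → shiftDown (insert (x , a)) i ≡ coord x i
      coords i with i <? M
      ... | yes i<M = spliceIn-< i<M
      ... | no i≮M  = begin
        transfer T (spliceIn x a (suc i))      ≡⟨ cong (transfer T) (spliceIn-> M≤i) ⟩
        transfer T (transfer T (coord x i))    ≡⟨ transfer-transfer (2T<2+i (ℕ.m≤n⇒m≤1+n M≤i)) (ℕ.m≤n⇒m≤1+n (small i M≤i)) ⟩
        coord x i                              ∎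
        where
          open ≡-Reasoning
          M≤i : M ≤ i
          M≤i = ℕ.≮⇒≥ i≮M

  extract-step : ∀ {z z'} → Small R z → UnitStep z z' → UnitStep' (extract z) (extract z')
  extract-step {z} {z'} small (j , zⱼ─z'ⱼ , same) with around M j
  ... | below j<M = inj₁ ((j , subst₂ _─_ (sym (shiftDown-< j<M)) (sym (shiftDown-< j<M)) zⱼ─z'ⱼ , same↓) ,
                           cong (signed T) (same M (λ M≡j → ℕ.<⇒≢ j<M (sym M≡j))))
    where
      same↓ : ∀ i → i ≢ j → shiftDown z i ≡ shiftDown z' i
      same↓ i i≢j = shiftDown-cong i (λ _ → same i i≢j)
                      (λ M≤i → same (suc i) (λ 1+i≡j → ℕ.<⇒≢ (ℕ.<-trans j<M (s≤s M≤i)) (sym 1+i≡j)))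
  ... | at = inj₂ (same↓ , signed-─ (2T<2+i ℕ.≤-refl) zⱼ─z'ⱼ (s≤s (small M ℕ.≤-refl)))
    where
      same↓ : ∀ i → shiftDown z i ≡ shiftDown z' i
      same↓ i = shiftDown-cong i (λ i<M → same i (ℕ.<⇒≢ i<M)) (λ M≤i → same (suc i) (λ 1+i≡M → ℕ.<⇒≢ (s≤s M≤i) (sym 1+i≡M)))
  ... | above {j'} M≤j' = inj₁ ((j' , step↓ , same↓) , cong (signed T) (same M (ℕ.<⇒≢ (s≤s M≤j'))))
    where
      step↓ : shiftDown z j' ─ shiftDown z' j'
      step↓ = subst₂ _─_ (sym (shiftDown-≥ M≤j')) (sym (shiftDown-≥ M≤j'))
                (transfer-─ (2T<2+i (ℕ.m≤n⇒m≤1+n M≤j')) zⱼ─z'ⱼ (s≤s (small (suc j') (ℕ.m≤n⇒m≤1+n M≤j'))))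
      same↓ : ∀ i → i ≢ j' → shiftDown z i ≡ shiftDown z' i
      same↓ i i≢j' = shiftDown-cong i (λ i<M → same i (ℕ.<⇒≢ (ℕ.<-≤-trans i<M (ℕ.m≤n⇒m≤1+n M≤j'))))
                       (λ _ → same (suc i) (λ 1+i≡1+j' → i≢j' (ℕ.suc-injective 1+i≡1+j')))

  insert-step : ∀ {x a x' a'} → Small R x → UnitStep' (x , a) (x' , a') → UnitStep (insert (x , a)) (insert (x' , a'))
  insert-step {x} {a} {x'} {a'} small (inj₁ ((j , xⱼ─x'ⱼ , same) , a≡a')) with j <? M
  ... | yes j<M = j , subst₂ _─_ (sym (spliceIn-< j<M)) (sym (spliceIn-< j<M)) xⱼ─x'ⱼ , same↑
    where
      same↑ : ∀ i → i ≢ j → spliceIn x a i ≡ spliceIn x' a' i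
      same↑ i i≢j = spliceIn-cong i (λ _ → same i i≢j) (λ _ → a≡a')
                      (λ {i'} _ M≤i' → same i' (λ i'≡j → ℕ.<⇒≢ (ℕ.<-≤-trans j<M M≤i') (sym i'≡j)))
  ... | no j≮M = suc j , step↑ , same↑
    where
      M≤j : M ≤ j
      M≤j = ℕ.≮⇒≥ j≮M
      step↑ : spliceIn x a (suc j) ─ spliceIn x' a' (suc j)
      step↑ = subst₂ _─_ (sym (spliceIn-> M≤j)) (sym (spliceIn-> M≤j))
                (transfer-─ (2T<2+i M≤j) xⱼ─x'ⱼ (s≤s (small j M≤j)))
      same↑ : ∀ i → i ≢ suc j → spliceIn x a i ≡ spliceIn x' a' i
      same↑ i i≢1+j = spliceIn-cong i (λ i<M → same i (ℕ.<⇒≢ (ℕ.<-≤-trans i<M M≤j))) (λ _ → a≡a')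
                        (λ {i'} i≡1+i' _ → same i' (λ i'≡j → i≢1+j (trans i≡1+i' (cong suc i'≡j))))
  insert-step {x} {a} {x'} {a'} small (inj₂ (x≈x' , a─a')) =
    M , subst₂ _─_ (sym spliceIn-M) (sym spliceIn-M) (reduce-─ a─a') , same↑
    where
      same↑ : ∀ i → i ≢ M → spliceIn x a i ≡ spliceIn x' a' i
      same↑ i i≢M = spliceIn-cong i (λ _ → x≈x' i) (λ i≡M → ⊥-elim (i≢M i≡M)) (λ {i'} _ _ → x≈x' i')

  Small-≤ : ∀ {r s z} → r ≤ s → Small r z → Small s z
  Small-≤ r≤s small i M≤i = ℕ.≤-trans (small i M≤i) r≤s

  Small-resp : ∀ {r z z'} → z ≈D z' → Small r z → Small r z'
  Small-resp z≈z' small i M≤i = subst (λ c → ∣ signed T c ∣ ≤ _) (z≈z' i) (small i M≤i)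

  Small-step : ∀ {r z z'} → r < T → UnitStep z z' → Small r z → Small (suc r) z'
  Small-step {z = z} {z'} r<T (j , zⱼ─z'ⱼ , same) small i M≤i with i ≟ j
  ... | yes refl = signed-─-bound (2T<2+i M≤i) {coord z i} {coord z' i} zⱼ─z'ⱼ r<T (small i M≤i)
  ... | no i≢j   = subst (λ c → ∣ signed T c ∣ ≤ _) (same i i≢j) (ℕ.m≤n⇒m≤1+n (small i M≤i))

  Small'-step : ∀ {r p q} → r < T → UnitStep' p q → Small' r p → Small' (suc r) q
  Small'-step {p = x , _} {y , _} r<T (inj₁ (step , refl)) (small , ∣a∣≤r) =
    Small-step {z = x} {y} r<T step small , ℕ.m≤n⇒m≤1+n ∣a∣≤r
  Small'-step {p = x , _} {y , _} r<T (inj₂ (x≈y , a─b)) (small , ∣a∣≤r) =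
    Small-≤ {z = y} (ℕ.n≤1+n _) (Small-resp {z = x} {y} x≈y small) , ℕ.≤-trans (─ℤ⇒∣b∣≤1+∣a∣ a─b) (s≤s ∣a∣≤r)

  extract-ε : extract zeroD 𝔾'.≈ 𝔾'.ε
  extract-ε = zero-coords , refl
    where
      zero-coords : ∀ i → shiftDown zeroD i ≡ fzero
      zero-coords i with i ℕ.<? M
      ... | yes _ = refl
      ... | no _  = refl

  within⇒Small : ∀ {u x r} → r ≤ R → Within CayG u x r → Small r (u 𝔾.\\ x)
  within⇒Small {u} {x} {zero} _ u≈x =
    Small-resp {z = zeroD} {u 𝔾.\\ x} (𝔾.sym {u 𝔾.\\ x} {zeroD} (𝔾.x≈y⇒x\\y≈ε {u} {x} u≈x)) (λ _ _ → z≤n)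
  within⇒Small {u} {x} {suc r} r<R (inj₁ x∈) = Small-≤ {z = u 𝔾.\\ x} (ℕ.n≤1+n r) (within⇒Small (ℕ.<⇒≤ r<R) x∈)
  within⇒Small {u} {x} {suc r} r<R (inj₂ (w , w∈ , w~x)) =
    Small-step {z = u 𝔾.\\ w} {u 𝔾.\\ x} (s≤s (ℕ.<⇒≤ r<R))
      (~⇒UnitStep {u 𝔾.\\ w} {u 𝔾.\\ x} (𝔾.~-translate (u 𝔾.⁻¹) {w} {x} w~x)) (within⇒Small (ℕ.<⇒≤ r<R) w∈)

  within⇒Small' : ∀ {v q r} → r ≤ R → Within CayG' v q r → Small' r (v 𝔾'.\\ q)
  within⇒Small' {v} {q} {zero} _ v≈q =
    Small-resp {z = zeroD} {proj₁ (v 𝔾'.\\ q)} (𝔾.sym {proj₁ (v 𝔾'.\\ q)} {zeroD} (proj₁ ε≈)) (λ _ _ → z≤n) ,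
    subst (λ k → ∣ k ∣ ≤ 0) (sym (proj₂ ε≈)) z≤n
    where
      ε≈ : (v 𝔾'.\\ q) 𝔾'.≈ 𝔾'.ε
      ε≈ = 𝔾'.x≈y⇒x\\y≈ε {v} {q} v≈q
  within⇒Small' {v} {q} {suc r} r<R (inj₁ q∈) =
    let (small , ∣a∣≤r) = within⇒Small' (ℕ.<⇒≤ r<R) q∈
    in Small-≤ {z = proj₁ (v 𝔾'.\\ q)} (ℕ.n≤1+n r) small , ℕ.m≤n⇒m≤1+n ∣a∣≤r
  within⇒Small' {v} {q} {suc r} r<R (inj₂ (w , w∈ , w~q)) =
    Small'-step {p = v 𝔾'.\\ w} {v 𝔾'.\\ q} (s≤s (ℕ.<⇒≤ r<R))
      (~'⇒UnitStep' {v 𝔾'.\\ w} {v 𝔾'.\\ q} (𝔾'.~-translate (v 𝔾'.⁻¹) {w} {q} w~q)) (within⇒Small' (ℕ.<⇒≤ r<R) w∈)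

  module _ (u : DSum) (v : DSum × ℤ) where

    to : DSum → DSum × ℤ
    to x = v 𝔾'.∙ extract (u 𝔾.\\ x)

    from : DSum × ℤ → DSum
    from q = u 𝔾.∙ insert (v 𝔾'.\\ q)

    localIso : LocalIso CayG CayG' u v R
    localIso .LocalIso.to = to
    localIso .LocalIso.from = from
    localIso .LocalIso.to-cong {x} {y} x≈y =
      𝔾'.∙-congˡ {v} {extract (u 𝔾.\\ x)} {extract (u 𝔾.\\ y)} (extract-cong {u 𝔾.\\ x} {u 𝔾.\\ y} (𝔾.∙-congˡ {u 𝔾.⁻¹} {x} {y} x≈y))
    localIso .LocalIso.from-cong {p} {q} p≈q =
      𝔾.∙-congˡ {u} {insert (v 𝔾'.\\ p)} {insert (v 𝔾'.\\ q)} (insert-cong {v 𝔾'.\\ p} {v 𝔾'.\\ q} (𝔾'.∙-congˡ {v 𝔾'.⁻¹} {p} {q} p≈q))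
    localIso .LocalIso.to-root = begin
      v                              ≈⟨ 𝔾'.identityʳ v ⟨
      v 𝔾'.∙ 𝔾'.ε                    ≈⟨ 𝔾'.∙-congˡ {v} {extract zeroD} {𝔾'.ε} extract-ε ⟨
      v 𝔾'.∙ extract zeroD           ≈⟨ 𝔾'.∙-congˡ {v} {extract (u 𝔾.\\ u)} {extract zeroD} (extract-cong {u 𝔾.\\ u} {zeroD} (𝔾.inverseˡ u)) ⟨
      v 𝔾'.∙ extract (u 𝔾.\\ u)     ∎
      where open import Relation.Binary.Reasoning.Setoid 𝔾'.setoid
    localIso .LocalIso.Dom x = Small R (u 𝔾.\\ x)
    localIso .LocalIso.Cod q = Small' R (v 𝔾'.\\ q)
    localIso .LocalIso.ball⊆Dom = within⇒Small ℕ.≤-refl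
    localIso .LocalIso.ball⊆Cod = within⇒Small' ℕ.≤-refl
    localIso .LocalIso.from∘to {x} small = begin
      u 𝔾.∙ insert (v 𝔾'.\\ to x)
        ≈⟨ 𝔾.∙-congˡ {u} {insert (v 𝔾'.\\ to x)} {insert (extract (u 𝔾.\\ x))}
             (insert-cong {v 𝔾'.\\ to x} (𝔾'.\\-leftDividesʳ v (extract (u 𝔾.\\ x)))) ⟩
      u 𝔾.∙ insert (extract (u 𝔾.\\ x))
        ≈⟨ 𝔾.∙-congˡ {u} {insert (extract (u 𝔾.\\ x))} {u 𝔾.\\ x} (insert-extract {u 𝔾.\\ x} small) ⟩
      u 𝔾.∙ (u 𝔾.\\ x)
        ≈⟨ 𝔾.\\-leftDividesˡ u x ⟩
      x ∎
      where open import Relation.Binary.Reasoning.Setoid 𝔾.setoid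
    localIso .LocalIso.to∘from {q} small = begin
      v 𝔾'.∙ extract (u 𝔾.\\ from q)
        ≈⟨ 𝔾'.∙-congˡ {v} {extract (u 𝔾.\\ from q)} {extract (insert (v 𝔾'.\\ q))}
             (extract-cong {u 𝔾.\\ from q} (𝔾.\\-leftDividesʳ u (insert (v 𝔾'.\\ q)))) ⟩
      v 𝔾'.∙ extract (insert (v 𝔾'.\\ q))
        ≈⟨ 𝔾'.∙-congˡ {v} {extract (insert (v 𝔾'.\\ q))} {v 𝔾'.\\ q} (extract-insert {v 𝔾'.\\ q} small) ⟩
      v 𝔾'.∙ (v 𝔾'.\\ q)
        ≈⟨ 𝔾'.\\-leftDividesˡ v q ⟩
      q ∎
      where open import Relation.Binary.Reasoning.Setoid 𝔾'.setoid
    localIso .LocalIso.to-adj {x} {y} dom x~y =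
      𝔾'.~-translate v {extract (u 𝔾.\\ x)} {extract (u 𝔾.\\ y)}
        (UnitStep'⇒~' {extract (u 𝔾.\\ x)} {extract (u 𝔾.\\ y)}
          (extract-step {u 𝔾.\\ x} {u 𝔾.\\ y} dom (~⇒UnitStep {u 𝔾.\\ x} {u 𝔾.\\ y} (𝔾.~-translate (u 𝔾.⁻¹) {x} {y} x~y))))
    localIso .LocalIso.from-adj {p} {q} (small , _) p~q =
      𝔾.~-translate u {insert (v 𝔾'.\\ p)} {insert (v 𝔾'.\\ q)}
        (UnitStep⇒~ {insert (v 𝔾'.\\ p)} {insert (v 𝔾'.\\ q)}
          (insert-step small (~'⇒UnitStep' {v 𝔾'.\\ p} {v 𝔾'.\\ q} (𝔾'.~-translate (v 𝔾'.⁻¹) {p} {q} p~q))))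
    localIso .LocalIso.~Γ-resp {x} {x'} {y} {y'} = 𝔾.~-resp-≈ {x} {x'} {y} {y'}
    localIso .LocalIso.~Δ-resp {p} {p'} {q} {q'} = 𝔾'.~-resp-≈ {p} {p'} {q} {q'}

weakly-isomorphic : WeaklyIsomorphic CayG CayG'
weakly-isomorphic k u v = LocalIso⇒RootedBallIso (Splice.localIso (suc k) u v)

-- Non-isomorphism

·-coord : ∀ k d i → coord (k 𝔾.· d) i ≡ k ℤ/.· coord d i
·-coord zero    d i = refl
·-coord (suc k) d i = cong (addFin (coord d i)) (·-coord k d i)

Gen±-torsion : ∀ d → 𝔾.Gen± d → Σ[ t ∈ ℕ ] (suc t 𝔾.· d) ≈D zeroD
Gen±-torsion d gen with Gen±⇒IsUnitAt {d} gen
... | j , _ , d₀ = suc j , λ i → trans (·-coord (suc (suc j)) d i) (vanish i)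
  where
    vanish : ∀ i → suc (suc j) ℤ/.· coord d i ≡ fzero
    vanish i with i ≟ j
    ... | yes refl = m·c≡0 (coord d i)
    ... | no i≢j   = trans (cong (suc (suc j) ℤ/.·_) (d₀ i i≢j)) (ℤ/.×-idem (ℤ/.identityˡ fzero) (suc (suc j)))

level : ℕ → DSum × ℤ
level k = zeroD , + k

level-adjacent : ∀ k → level k 𝔾'.~ level (suc k)
level-adjacent k = UnitStep'⇒~' {level k} {level (suc k)} (inj₂ ((λ _ → refl) , inj₁ refl))

private
  +≢+1+ : ∀ i c → + i ≢ + suc (c ℕ.+ i)
  +≢+1+ i c eq = ℕ.m≢1+n+m i (ℤ.+-injective eq)

-- a neighbour of level k lies at height k, or on the vertical line at height k ± 1
level-middle : ∀ k p → p 𝔾'.~ level k → p 𝔾'.~ level (suc (suc k)) → p 𝔾'.≈ level (suc k)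
level-middle k (x , a) p~k p~k+2 =
  middle (~'⇒UnitStep' {x , a} {level k} p~k) (~'⇒UnitStep' {x , a} {level (suc (suc k))} p~k+2)
  where
    middle : UnitStep' (x , a) (level k) → UnitStep' (x , a) (level (suc (suc k))) → (x , a) 𝔾'.≈ level (suc k)
    middle (inj₂ (x≈0 , inj₂ refl)) (inj₂ (_ , inj₁ _))    = x≈0 , refl
    middle (inj₁ (_ , refl))        (inj₁ (_ , eq))        = ⊥-elim (+≢+1+ k 1 eq)
    middle (inj₁ (_ , refl))        (inj₂ (_ , inj₁ eq))   = ⊥-elim (+≢+1+ (suc k) 0 (sym eq))
    middle (inj₁ (_ , refl))        (inj₂ (_ , inj₂ eq))   = ⊥-elim (+≢+1+ k 2 eq)
    middle (inj₂ (_ , inj₁ eq))     (inj₁ (_ , refl))      = ⊥-elim (+≢+1+ k 2 eq)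
    middle (inj₂ (_ , inj₁ eq))     (inj₂ (_ , inj₁ eq'))  = ⊥-elim (+≢+1+ k 1 (trans eq (sym eq')))
    middle (inj₂ (_ , inj₁ eq))     (inj₂ (_ , inj₂ refl)) = ⊥-elim (+≢+1+ k 3 eq)
    middle (inj₂ (_ , inj₂ refl))   (inj₁ (_ , eq))        = ⊥-elim (+≢+1+ (suc k) 0 eq)
    middle (inj₂ (_ , inj₂ refl))   (inj₂ (_ , inj₂ eq))   = ⊥-elim (+≢+1+ (suc k) 1 eq)

module _ (φ : Iso CayG CayG') where
  private
    open Iso φ
    to : DSum → DSum × ℤ
    to = Inverse.to bij

    from : DSum × ℤ → DSum
    from = Inverse.from bij

    to∘from : ∀ p → to (from p) 𝔾'.≈ p
    to∘from p = Inverse.inverseˡ bij {p} {from p} (𝔾.refl {from p})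

    to-adj-from : ∀ {x p} → x 𝔾.~ from p → to x 𝔾'.~ p
    to-adj-from {x} {p} x~from-p = 𝔾'.~-resp-≈ {to x} {to x} {to (from p)} {p} (𝔾'.refl {to x}) (to∘from p)
                                     (Equivalence.to (adj x (from p)) x~from-p)

    from-adj : ∀ {p q} → p 𝔾'.~ q → from p 𝔾.~ from q
    from-adj {p} {q} p~q = Equivalence.from (adj (from p) (from q))
      (𝔾'.~-resp-≈ {p} {to (from p)} {q} {to (from q)} (𝔾'.sym {to (from p)} {p} (to∘from p)) (𝔾'.sym {to (from q)} {q} (to∘from q)) p~q)

  line : ℕ → DSum
  line k = from (level k)

  line-adjacent : ∀ k → line k 𝔾.~ line (suc k)
  line-adjacent k = from-adj {level k} {level (suc k)} (level-adjacent k)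

  line-middle : ∀ k x → x 𝔾.~ line k → x 𝔾.~ line (suc (suc k)) → x ≈D line (suc k)
  line-middle k x x~k x~k+2 = 𝔾.sym {line (suc k)} {x} (Inverse.inverseʳ bij {x} {level (suc k)} (𝔾'.sym {to x} {level (suc k)} to-x≈))
    where
      to-x≈ : to x 𝔾'.≈ level (suc k)
      to-x≈ = level-middle k (to x) (to-adj-from {x} {level k} x~k) (to-adj-from {x} {level (suc (suc k))} x~k+2)

  line-injective : ∀ {a b} → line a ≈D line b → a ≡ b
  line-injective {a} {b} la≈lb = ℤ.+-injective (proj₂ level-a≈level-b)
    where
      level-a≈level-b : level a 𝔾'.≈ level b
      level-a≈level-b = 𝔾'.trans {level a} {to (line a)} {level b} (𝔾'.sym {to (line a)} {level a} (to∘from (level a)))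
                          (𝔾'.trans {to (line a)} {to (line b)} {level b} (Inverse.to-cong bij la≈lb) (to∘from (level b)))

  line-returns : Σ[ t ∈ ℕ ] line (suc t) ≈D line 0
  line-returns = StraightPaths.straight-path-returns DSum-abelianGroup SGen SGen∌ε
                   Gen±-torsion line line-adjacent line-middle

  not-isomorphic : ⊥
  not-isomorphic = ℕ.0≢1+n (sym (line-injective {suc (proj₁ line-returns)} {0} (proj₂ line-returns)))

mainTheorem5 : WeaklyIsomorphic CayG CayG' × ¬ (Iso CayG CayG')
mainTheorem5 = weakly-isomorphic , not-isomorphic
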